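{- Let $M=(X,rk)$ be a loopless matroid with Tutte polynomial $T_M(x,y)$. Then (1) $[x^{rk(M)}]T_M(x,0)=1$; (2) $[x^{rk(M)-1}]T_M(x,0)=p(M)-rk(M)$; (3) $[x^{rk(M)-2}]T_M(x,0)=\binom{rk(M)}{2}-(rk(M)-1)p(M)+\sum_{F\in\mathcal{F}_2(M)}(p(F)-1)$.
   Context: A matroid $M=(X,rk)$ is a finite set $X$ with a rank function $rk:2^X\to\mathbb{Z}_{\ge0}$ satisfying $rk(A)\le|A|$, monotonicity and submodularity; $rk(M)=rk(X)$; loopless means no $e$ with $rk(\{e\})=0$. The Tutte polynomial is $T_M(x,y)=\sum_{A\subseteq X}(x-1)^{rk(X)-rk(A)}(y-1)^{|A|-rk(A)}$. $[x^i]f(x)$ denotes the coefficient of $x^i$ in $f$. A flat is a set $F$ with $\{e: rk(F\cup\{e\})=rk(F)\}=F$; $\mathcal{F}_2(M)$ is the set of flats of rank $2$. Elements $e,f$ are parallel if $rk(\{e,f\})=rk(\{e\})=rk(\{f\})=1$; a parallel class is a maximal set of non-loop elements pairwise parallel. $p(M)$ is the number of parallel classes of $M$, and for $F\subseteq X$, $p(F)$ is the number of parallel classes of the restriction $M|F$. -}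

module Defs where

open import Data.Bool using (Bool; true; false; _∧_; not; if_then_else_)
open import Data.Nat as ℕ using (ℕ; zero; suc; _≤_; _∸_; _≡ᵇ_)
open import Data.Integer as ℤ using (ℤ; +_; -[1+_]; -_)
open import Data.Fin using (Fin)
open import Data.Fin.Subset using (Subset; ⁅_⁆; _∪_; _∩_; _⊆_; ∣_∣; ⊤)
open import Data.List using (List; []; _∷_; map; foldr; length; allFin)
open import Data.Bool.ListAction using (any; all)
open import Data.Vec using (Vec; lookup) renaming ([] to []ᵥ; _∷_ to _∷ᵥ_)
open import Relation.Nullary.Decidable using (Dec; yes; no)
open import Relation.Binary.PropositionalEquality using (_≡_)
open import Relation.Unary using (Pred)

record Matroid : Set where
  field
    n         : ℕ
    rk        : Subset n → ℕ
    rk-card   : ∀ A → rk A ≤ ∣ A ∣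
    rk-mono   : ∀ {A B} → A ⊆ B → rk A ≤ rk B
    rk-submod : ∀ A B → rk (A ∪ B) ℕ.+ rk (A ∩ B) ≤ rk A ℕ.+ rk B

open Matroid public

rkM : Matroid → ℕ
rkM M = rk M ⊤

Loopless : Matroid → Set
Loopless M = ∀ (e : Fin (n M)) → ¬0 (rk M ⁅ e ⁆)
  where
  ¬0 : ℕ → Set
  ¬0 k = k ≡ 0 → Data.Empty.⊥
    where import Data.Empty

allSubsets : (n : ℕ) → List (Subset n)
allSubsets zero    = []ᵥ ∷ []
allSubsets (suc n) = map (false ∷ᵥ_) (allSubsets n) Data.List.++ map (true ∷ᵥ_) (allSubsets n)
  where import Data.List

filterᵇ : {A : Set} → (A → Bool) → List A → List A
filterᵇ P []       = []
filterᵇ P (x ∷ xs) = if P x then x ∷ filterᵇ P xs else filterᵇ P xs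

countSubsets : (n : ℕ) → (Subset n → Bool) → ℕ
countSubsets n P = length (filterᵇ P (allSubsets n))

-- Polynomials with coefficients in A as coefficient lists
-- (constant term first).

module Poly {A : Set} (0# 1# : A) (_+_ _*_ : A → A → A) where
  addP : List A → List A → List A
  addP []       q        = q
  addP (a ∷ p)  []       = a ∷ p
  addP (a ∷ p)  (b ∷ q)  = (a + b) ∷ addP p q

  scaleP : A → List A → List A
  scaleP a = map (a *_)

  mulP : List A → List A → List A
  mulP []      q = []
  mulP (a ∷ p) q = addP (scaleP a q) (0# ∷ mulP p q)

  oneP : List A
  oneP = 1# ∷ []

  powP : List A → ℕ → List A
  powP p zero    = oneP
  powP p (suc k) = mulP p (powP p k)

  sumP : List (List A) → List A
  sumP = foldr addP []

  evalP : A → List A → A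
  evalP c = foldr (λ a acc → a + (c * acc)) 0#

PolyZ : Set
PolyZ = List ℤ

module PZ = Poly (+ 0) (+ 1) ℤ._+_ ℤ._*_

-- ℤ[y][x] : polynomials in x whose coefficients are polynomials in y
Poly2 : Set
Poly2 = List PolyZ

module P2 = Poly [] (+ 1 ∷ []) PZ.addP PZ.mulP

x-1 : Poly2
x-1 = ((- + 1) ∷ []) ∷ (+ 1 ∷ []) ∷ []

y-1 : Poly2
y-1 = ((- + 1) ∷ + 1 ∷ []) ∷ []

-- coefficient [x^i] of a univariate integer polynomial, for i ∈ ℤ
-- (zero for negative i and beyond the degree)
coeffℕ : ℕ → PolyZ → ℤ
coeffℕ i       []      = + 0
coeffℕ zero    (a ∷ p) = a
coeffℕ (suc i) (a ∷ p) = coeffℕ i p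

coeff : ℤ → PolyZ → ℤ
coeff (+ i)    p = coeffℕ i p
coeff -[1+ i ] p = + 0

-- Tutte polynomial
-- T_M(x,y) = Σ_{A ⊆ X} (x-1)^{rk(X)-rk(A)} (y-1)^{|A|-rk(A)}
-- (both exponents are ≥ 0 by the matroid axioms, so ∸ is exact)

Tutte : Matroid → Poly2
Tutte M = P2.sumP (map term (allSubsets (n M)))
  where
  term : Subset (n M) → Poly2
  term A = P2.mulP (P2.powP x-1 (rkM M ∸ rk M A))
                   (P2.powP y-1 (∣ A ∣ ∸ rk M A))

TutteX0 : Matroid → PolyZ
TutteX0 M = map (PZ.evalP (+ 0)) (Tutte M)

module _ (M : Matroid) where
  private
    X = Fin (n M)
    elems = allFin (n M)

  nonloopᵇ : X → Bool
  nonloopᵇ e = not (rk M ⁅ e ⁆ ≡ᵇ 0)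

  parallelᵇ : X → X → Bool
  parallelᵇ e f = (rk M (⁅ e ⁆ ∪ ⁅ f ⁆) ≡ᵇ 1) ∧ (rk M ⁅ e ⁆ ≡ᵇ 1) ∧ (rk M ⁅ f ⁆ ≡ᵇ 1)

  -- C is a parallel class of the restriction M|F: a nonempty maximal set of
  -- non-loop elements of F that are pairwise parallel
  -- (maximality: every non-loop e ∈ F parallel to all members of C lies in C)
  parClassInᵇ : Subset (n M) → Subset (n M) → Bool
  parClassInᵇ F C =
    any (lookup C) elems
    ∧ all (λ e → if lookup C e then lookup F e ∧ nonloopᵇ e else true) elems
    ∧ all (λ e → all (λ f → if lookup C e ∧ lookup C f then parallelᵇ e f else true) elems) elems
    ∧ all (λ e → if lookup F e ∧ nonloopᵇ e ∧ all (λ f → if lookup C f then parallelᵇ e f else true) elems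
                 then lookup C e else true) elems

  pF : Subset (n M) → ℕ
  pF F = countSubsets (n M) (parClassInᵇ F)

  pM : ℕ
  pM = pF ⊤

  isFlatᵇ : Subset (n M) → Bool
  isFlatᵇ F = all (λ e → eqᵇ (rk M (F ∪ ⁅ e ⁆) ≡ᵇ rk M F) (lookup F e)) elems
    where
    eqᵇ : Bool → Bool → Bool
    eqᵇ true  b = b
    eqᵇ false b = not b

  flats2 : List (Subset (n M))
  flats2 = filterᵇ (λ F → isFlatᵇ F ∧ (rk M F ≡ᵇ 2)) (allSubsets (n M))

  sumFlats2 : ℤ
  sumFlats2 = foldr ℤ._+_ (+ 0) (map (λ F → + pF F ℤ.- + 1) flats2)

-- Expanding T_M(x,0) = Σ_A (x-1)^(r - rk A) (-1)^(|A| - rk A), the coefficient of x^(r-t)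
-- for t ≤ 2 only involves sets of rank at most t, through the signed counts
-- σ_j = Σ_{rk A = j} (-1)^|A|. Since M is loopless, ∅ is the only set of rank 0, so σ_0 = 1.
-- The sets of rank 1 are the nonempty subsets of the parallel classes, and the nonempty
-- subsets of one class contribute -1, so σ_1 = -p(M). Every set of rank 2 lies in exactly
-- one rank-2 flat F, its closure; as the alternating sum over all subsets of F vanishes,
-- the rank-2 subsets of F contribute -(σ_0(F) + σ_1(F)) = p(F) - 1.

module Submission where

open import Defs
open import Data.Bool using (Bool; true; false; T; not; _∧_; if_then_else_)
import Data.Bool as Bool
open import Data.Bool.ListAction using (all; any)
open import Data.Bool.Properties using (T-≡; T-∧)
open import Data.Empty using (⊥-elim)
open import Data.Fin using (Fin)
open import Data.Fin.Subset using (Subset; inside; outside; _⊆_; _∈_; ⊥; ⊤; ∣_∣; Nonempty; _∪_; _∩_; ⁅_⁆; ⋃)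
open import Data.Fin.Subset.Properties
  using (_⊆?_; _∈?_; ⊥⊆; ⊆⊤; ⊆-refl; ⊆-reflexive; ⊆-trans; ⊆-antisym; ∉⊥; x∈⁅x⁆; x∈⁅y⁆⇒x≡y;
         x∈p∪q⁻; p⊆p∪q; q⊆p∪q; x∈p∩q⁺; ∪-assoc; ∪-comm; ∪-identityʳ; ∣⁅x⁆∣≡1; ∣⊥∣≡0;
         nonempty?; Empty-unique)
open import Data.Integer using (ℤ; +_; 0ℤ; 1ℤ; -1ℤ; -_; _+_; _-_; _*_; _^_)
import Data.Integer.Properties as ℤ
open import Data.Integer.Tactic.RingSolver using (solve-∀)
open import Algebra.Properties.CommutativeSemigroup ℤ.+-commutativeSemigroup
  using () renaming (interchange to +-interchange)
open import Data.List using (List; []; _∷_; map; foldr; length; _++_; filter; allFin)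
open import Data.List.Membership.Propositional using () renaming (_∈_ to _∈ₗ_)
open import Data.List.Membership.Propositional.Properties using (∈-filter⁺; ∈-allFin)
import Data.List.Properties as List
open import Data.List.Relation.Unary.All as All using (All; []; _∷_)
open import Data.List.Relation.Unary.All.Properties using (all-filter; all⁺; all⁻)
open import Data.List.Relation.Unary.Any as Any using (here; there)
open import Data.List.Relation.Unary.Any.Properties using (any⁺; any⁻)
open import Data.Nat as ℕ using (ℕ; zero; suc; _∸_; _≤_; _<_; z≤n; s≤s; _≡ᵇ_)
open import Data.Nat.Combinatorics using (_C_; nC1≡n; nCk+nC[k+1]≡[n+1]C[k+1])
import Data.Nat.Properties as NP
open import Data.Product using (_×_; _,_; proj₁; proj₂; ∃; ∃-syntax)
open import Data.Sum using (_⊎_; inj₁; inj₂)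
open import Data.Vec using (_∷_; lookup; tabulate) renaming ([] to [])
import Data.Vec.Properties as Vec
open import Function using (_∘_; _⇔_; mk⇔; Equivalence)
open Equivalence using (to; from)
open import Relation.Binary.Definitions using (DecidableEquality)
open import Relation.Binary.PropositionalEquality
  using (_≡_; _≢_; refl; sym; trans; cong; cong₂; subst; module ≡-Reasoning)
open import Relation.Nullary using (does; yes; no; ¬_; contradiction)
open import Relation.Nullary.Decidable using (Dec; dec-true; dec-false)

-- Sums over all subsets of Fin n

∑ : ∀ {n} → (Subset n → ℤ) → ℤ
∑ {zero}  f = f []
∑ {suc n} f = ∑ (f ∘ (outside ∷_)) + ∑ (f ∘ (inside ∷_))

infixr 6.5 ∑
syntax ∑ (λ A → e) = ∑[ A ] e

infixr 8 [_]·_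

[_]·_ : Bool → ℤ → ℤ
[ b ]· x = if b then x else 0ℤ

sign : ∀ {n} → Subset n → ℤ
sign A = -1ℤ ^ ∣ A ∣

∑-cong : ∀ {n} {f g : Subset n → ℤ} → (∀ A → f A ≡ g A) → ∑ f ≡ ∑ g
∑-cong {zero}  f≗g = f≗g []
∑-cong {suc n} f≗g = cong₂ _+_ (∑-cong (f≗g ∘ (outside ∷_))) (∑-cong (f≗g ∘ (inside ∷_)))

∑-zero : ∀ n → ∑ {n} (λ _ → 0ℤ) ≡ 0ℤ
∑-zero zero    = refl
∑-zero (suc n) = cong₂ _+_ (∑-zero n) (∑-zero n)

∑-+ : ∀ {n} (f g : Subset n → ℤ) → ∑[ A ] (f A + g A) ≡ ∑ f + ∑ g
∑-+ {zero}  f g = refl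
∑-+ {suc n} f g =
  trans (cong₂ _+_ (∑-+ (f ∘ (outside ∷_)) (g ∘ (outside ∷_))) (∑-+ (f ∘ (inside ∷_)) (g ∘ (inside ∷_))))
        (+-interchange (∑ (f ∘ (outside ∷_))) _ _ _)

∑-*ˡ : ∀ {n} c (f : Subset n → ℤ) → ∑[ A ] (c * f A) ≡ c * ∑ f
∑-*ˡ {zero}  c f = refl
∑-*ˡ {suc n} c f =
  trans (cong₂ _+_ (∑-*ˡ c (f ∘ (outside ∷_))) (∑-*ˡ c (f ∘ (inside ∷_))))
        (sym (ℤ.*-distribˡ-+ c (∑ (f ∘ (outside ∷_))) _))

∑-neg : ∀ {n} (f : Subset n → ℤ) → ∑[ A ] (- f A) ≡ - ∑ f
∑-neg {zero}  f = refl
∑-neg {suc n} f =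
  trans (cong₂ _+_ (∑-neg (f ∘ (outside ∷_))) (∑-neg (f ∘ (inside ∷_))))
        (sym (ℤ.neg-distrib-+ (∑ (f ∘ (outside ∷_))) _))

∑-comm : ∀ {m n} (g : Subset m → Subset n → ℤ) → ∑[ A ] ∑[ B ] g A B ≡ ∑[ B ] ∑[ A ] g A B
∑-comm {zero}  g = refl
∑-comm {suc m} g = begin
  ∑[ A ] ∑[ B ] g (outside ∷ A) B + ∑[ A ] ∑[ B ] g (inside ∷ A) B
    ≡⟨ cong₂ _+_ (∑-comm (g ∘ (outside ∷_))) (∑-comm (g ∘ (inside ∷_))) ⟩
  ∑[ B ] ∑[ A ] g (outside ∷ A) B + ∑[ B ] ∑[ A ] g (inside ∷ A) B
    ≡⟨ ∑-+ (λ B → ∑[ A ] g (outside ∷ A) B) (λ B → ∑[ A ] g (inside ∷ A) B) ⟨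
  ∑[ B ] ∑[ A ] g A B ∎
  where open ≡-Reasoning

[]·-T : ∀ {b} x → T b → [ b ]· x ≡ x
[]·-T {true} x _ = refl

[]·-neg : ∀ b x → [ b ]· (- x) ≡ - [ b ]· x
[]·-neg true  x = refl
[]·-neg false x = refl

[]·-zero : ∀ b → [ b ]· 0ℤ ≡ 0ℤ
[]·-zero true  = refl
[]·-zero false = refl

[]·-∧ : ∀ a b x → [ a ∧ b ]· x ≡ [ a ]· [ b ]· x
[]·-∧ true  b x = refl
[]·-∧ false b x = refl

infix 4 _≟ˢ_

_≟ˢ_ : ∀ {n} → DecidableEquality (Subset n)
_≟ˢ_ = Vec.≡-dec Bool._≟_

∑-delta : ∀ {n} (A₀ : Subset n) x → ∑[ A ] [ does (A ≟ˢ A₀) ]· x ≡ x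
∑-delta []              x = refl
∑-delta {suc n} (outside ∷ A₀) x =
  trans (cong₂ _+_ (∑-delta A₀ x) (∑-zero n)) (ℤ.+-identityʳ x)
∑-delta {suc n} (inside ∷ A₀) x =
  trans (cong₂ _+_ (∑-zero n) (∑-delta A₀ x)) (ℤ.+-identityˡ x)

∑-unique : ∀ {n} (P : Subset n → Bool) (g : Subset n → ℤ) {A₀} →
           T (P A₀) → (∀ {A} → T (P A) → A ≡ A₀) → ∑[ A ] [ P A ]· g A ≡ g A₀
∑-unique P g {A₀} PA₀ unique = trans (∑-cong pointwise) (∑-delta A₀ (g A₀))
  where
  pointwise : ∀ A → [ P A ]· g A ≡ [ does (A ≟ˢ A₀) ]· g A₀
  pointwise A with A ≟ˢ A₀
  ... | yes refl = []·-T (g A₀) PA₀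
  ... | no A≢A₀ with P A in PA
  ...   | true  = contradiction (unique (from T-≡ PA)) A≢A₀
  ...   | false = refl

∑-fibres : ∀ {m n} (R : Subset m → Subset n → Bool) (g : Subset n → ℤ) →
           (∀ A → g A ≡ 0ℤ ⊎ ∃[ P₀ ] T (R P₀ A) × (∀ {P} → T (R P A) → P ≡ P₀)) →
           ∑ g ≡ ∑[ P ] ∑[ A ] [ R P A ]· g A
∑-fibres {m} R g fibre = trans (∑-cong in-its-fibre) (∑-comm (λ A P → [ R P A ]· g A))
  where
  in-its-fibre : ∀ A → g A ≡ ∑[ P ] [ R P A ]· g A
  in-its-fibre A with fibre A
  ... | inj₁ gA≡0 rewrite gA≡0 = sym (trans (∑-cong (λ P → []·-zero (R P A))) (∑-zero m))
  ... | inj₂ (P₀ , R₀ , unique) = sym (∑-unique (λ P → R P A) (λ _ → g A) R₀ unique)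

∑-sign-⊆ : ∀ {n} (B : Subset n) → ∑[ A ] [ does (A ⊆? B) ]· sign A ≡ [ does (B ⊆? ⊥) ]· 1ℤ
∑-sign-⊆ []            = refl
∑-sign-⊆ {suc n} (outside ∷ B) =
  trans (cong₂ _+_ (∑-sign-⊆ B) (∑-zero n)) (ℤ.+-identityʳ _)
∑-sign-⊆ {suc n} (inside ∷ B) = begin
  S + ∑[ A ] [ does (A ⊆? B) ]· (-1ℤ * sign A) ≡⟨ cong (_+_ S) (∑-cong flip-sign) ⟩
  S + ∑[ A ] (- [ does (A ⊆? B) ]· sign A)     ≡⟨ cong (_+_ S) (∑-neg (λ A → [ does (A ⊆? B) ]· sign A)) ⟩
  S - S                                        ≡⟨ ℤ.+-inverseʳ S ⟩
  0ℤ                                           ∎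
  where
  open ≡-Reasoning
  S = ∑[ A ] [ does (A ⊆? B) ]· sign A
  flip-sign : ∀ A → [ does (A ⊆? B) ]· (-1ℤ * sign A) ≡ - [ does (A ⊆? B) ]· sign A
  flip-sign A = trans (cong ([ does (A ⊆? B) ]·_) (ℤ.-1*i≡-i (sign A))) ([]·-neg (does (A ⊆? B)) (sign A))

sumℤ : List ℤ → ℤ
sumℤ = foldr _+_ 0ℤ

sumℤ-++ : ∀ xs ys → sumℤ (xs ++ ys) ≡ sumℤ xs + sumℤ ys
sumℤ-++ []       ys = sym (ℤ.+-identityˡ _)
sumℤ-++ (x ∷ xs) ys = trans (cong (_+_ x) (sumℤ-++ xs ys)) (sym (ℤ.+-assoc x _ _))

sumℤ-allSubsets : ∀ n (f : Subset n → ℤ) → sumℤ (map f (allSubsets n)) ≡ ∑ f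
sumℤ-allSubsets zero    f = ℤ.+-identityʳ _
sumℤ-allSubsets (suc n) f = begin
  sumℤ (map f (map (outside ∷_) L ++ map (inside ∷_) L))
    ≡⟨ cong sumℤ (List.map-++ f (map (outside ∷_) L) _) ⟩
  sumℤ (map f (map (outside ∷_) L) ++ map f (map (inside ∷_) L))
    ≡⟨ sumℤ-++ (map f (map (outside ∷_) L)) _ ⟩
  sumℤ (map f (map (outside ∷_) L)) + sumℤ (map f (map (inside ∷_) L))
    ≡⟨ cong₂ _+_ (cong sumℤ (sym (List.map-∘ L))) (cong sumℤ (sym (List.map-∘ L))) ⟩
  sumℤ (map (f ∘ (outside ∷_)) L) + sumℤ (map (f ∘ (inside ∷_)) L)
    ≡⟨ cong₂ _+_ (sumℤ-allSubsets n _) (sumℤ-allSubsets n _) ⟩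
  ∑ f ∎
  where open ≡-Reasoning
        L = allSubsets n

sumℤ-filterᵇ : ∀ {A : Set} (P : A → Bool) (g : A → ℤ) xs →
               sumℤ (map g (filterᵇ P xs)) ≡ sumℤ (map (λ x → [ P x ]· g x) xs)
sumℤ-filterᵇ P g []       = refl
sumℤ-filterᵇ P g (x ∷ xs) with P x
... | true  = cong (_+_ (g x)) (sumℤ-filterᵇ P g xs)
... | false = trans (sumℤ-filterᵇ P g xs) (sym (ℤ.+-identityˡ _))

length-filterᵇ : ∀ {A : Set} (P : A → Bool) xs →
                 + length (filterᵇ P xs) ≡ sumℤ (map (λ x → [ P x ]· 1ℤ) xs)
length-filterᵇ P []       = refl
length-filterᵇ P (x ∷ xs) with P x
... | true  = trans (ℤ.pos-+ 1 _) (cong (_+_ 1ℤ) (length-filterᵇ P xs))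
... | false = trans (length-filterᵇ P xs) (sym (ℤ.+-identityˡ _))

countSubsets-∑ : ∀ n (P : Subset n → Bool) → + countSubsets n P ≡ ∑[ A ] [ P A ]· 1ℤ
countSubsets-∑ n P = trans (length-filterᵇ P (allSubsets n)) (sumℤ-allSubsets n _)

-- Coefficients of T_M(x,0)

eval₀ : PolyZ → ℤ
eval₀ = PZ.evalP 0ℤ

eval₀-∷ : ∀ a p → eval₀ (a ∷ p) ≡ a
eval₀-∷ a p = ℤ.+-identityʳ a

eval₀-addP : ∀ p q → eval₀ (PZ.addP p q) ≡ eval₀ p + eval₀ q
eval₀-addP []      q       = sym (ℤ.+-identityˡ _)
eval₀-addP (a ∷ p) []      = sym (ℤ.+-identityʳ _)
eval₀-addP (a ∷ p) (b ∷ q) = begin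
  eval₀ ((a + b) ∷ PZ.addP p q) ≡⟨ eval₀-∷ (a + b) (PZ.addP p q) ⟩
  a + b                        ≡⟨ cong₂ _+_ (eval₀-∷ a p) (eval₀-∷ b q) ⟨
  eval₀ (a ∷ p) + eval₀ (b ∷ q) ∎
  where open ≡-Reasoning

eval₀-scaleP : ∀ a q → eval₀ (PZ.scaleP a q) ≡ a * eval₀ q
eval₀-scaleP a []      = sym (ℤ.*-zeroʳ a)
eval₀-scaleP a (b ∷ q) = trans (eval₀-∷ (a * b) (PZ.scaleP a q)) (cong (_*_ a) (sym (eval₀-∷ b q)))

eval₀-mulP : ∀ p q → eval₀ (PZ.mulP p q) ≡ eval₀ p * eval₀ q
eval₀-mulP []      q = refl
eval₀-mulP (a ∷ p) q = begin
  eval₀ (PZ.addP (PZ.scaleP a q) (0ℤ ∷ PZ.mulP p q))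
    ≡⟨ eval₀-addP (PZ.scaleP a q) _ ⟩
  eval₀ (PZ.scaleP a q) + eval₀ (0ℤ ∷ PZ.mulP p q)
    ≡⟨ cong₂ _+_ (eval₀-scaleP a q) (eval₀-∷ 0ℤ (PZ.mulP p q)) ⟩
  a * eval₀ q + 0ℤ
    ≡⟨ ℤ.+-identityʳ _ ⟩
  a * eval₀ q
    ≡⟨ cong (_* eval₀ q) (eval₀-∷ a p) ⟨
  eval₀ (a ∷ p) * eval₀ q ∎
  where open ≡-Reasoning

map-eval₀-addP : ∀ P Q → map eval₀ (P2.addP P Q) ≡ PZ.addP (map eval₀ P) (map eval₀ Q)
map-eval₀-addP []      Q       = refl
map-eval₀-addP (a ∷ P) []      = refl
map-eval₀-addP (a ∷ P) (b ∷ Q) = cong₂ _∷_ (eval₀-addP a b) (map-eval₀-addP P Q)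

map-eval₀-mulP : ∀ P Q → map eval₀ (P2.mulP P Q) ≡ PZ.mulP (map eval₀ P) (map eval₀ Q)
map-eval₀-mulP []      Q = refl
map-eval₀-mulP (a ∷ P) Q = begin
  map eval₀ (P2.addP (P2.scaleP a Q) ([] ∷ P2.mulP P Q))
    ≡⟨ map-eval₀-addP (P2.scaleP a Q) _ ⟩
  PZ.addP (map eval₀ (map (PZ.mulP a) Q)) (0ℤ ∷ map eval₀ (P2.mulP P Q))
    ≡⟨ cong₂ PZ.addP scale (cong (0ℤ ∷_) (map-eval₀-mulP P Q)) ⟩
  PZ.addP (PZ.scaleP (eval₀ a) (map eval₀ Q)) (0ℤ ∷ PZ.mulP (map eval₀ P) (map eval₀ Q)) ∎
  where
  open ≡-Reasoning
  scale : map eval₀ (map (PZ.mulP a) Q) ≡ PZ.scaleP (eval₀ a) (map eval₀ Q)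
  scale = trans (sym (List.map-∘ Q)) (trans (List.map-cong (eval₀-mulP a) Q) (List.map-∘ Q))

map-eval₀-powP : ∀ P m → map eval₀ (P2.powP P m) ≡ PZ.powP (map eval₀ P) m
map-eval₀-powP P zero    = refl
map-eval₀-powP P (suc m) =
  trans (map-eval₀-mulP P (P2.powP P m)) (cong (PZ.mulP (map eval₀ P)) (map-eval₀-powP P m))

map-eval₀-sumP : ∀ Ps → map eval₀ (P2.sumP Ps) ≡ PZ.sumP (map (map eval₀) Ps)
map-eval₀-sumP []       = refl
map-eval₀-sumP (P ∷ Ps) =
  trans (map-eval₀-addP P (P2.sumP Ps)) (cong (PZ.addP (map eval₀ P)) (map-eval₀-sumP Ps))

coeffℕ-addP : ∀ i p q → coeffℕ i (PZ.addP p q) ≡ coeffℕ i p + coeffℕ i q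
coeffℕ-addP i       []      q       = sym (ℤ.+-identityˡ _)
coeffℕ-addP i       (a ∷ p) []      = sym (ℤ.+-identityʳ _)
coeffℕ-addP zero    (a ∷ p) (b ∷ q) = refl
coeffℕ-addP (suc i) (a ∷ p) (b ∷ q) = coeffℕ-addP i p q

coeffℕ-sumP : ∀ i ps → coeffℕ i (PZ.sumP ps) ≡ sumℤ (map (coeffℕ i) ps)
coeffℕ-sumP i []       = refl
coeffℕ-sumP i (p ∷ ps) =
  trans (coeffℕ-addP i p (PZ.sumP ps)) (cong (_+_ (coeffℕ i p)) (coeffℕ-sumP i ps))

coeffℕ-scaleP : ∀ i a p → coeffℕ i (PZ.scaleP a p) ≡ a * coeffℕ i p
coeffℕ-scaleP i       a []      = sym (ℤ.*-zeroʳ a)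
coeffℕ-scaleP zero    a (b ∷ p) = refl
coeffℕ-scaleP (suc i) a (b ∷ p) = coeffℕ-scaleP i a p

coeffℕ-mulP-const : ∀ i p d → coeffℕ i (PZ.mulP p (d ∷ [])) ≡ coeffℕ i p * d
coeffℕ-mulP-const i       []      d = refl
coeffℕ-mulP-const zero    (a ∷ p) d = ℤ.+-identityʳ _
coeffℕ-mulP-const (suc i) (a ∷ p) d = coeffℕ-mulP-const i p d

powP-const : ∀ c k → PZ.powP (c ∷ []) k ≡ (c ^ k ∷ [])
powP-const c zero    = refl
powP-const c (suc k) rewrite powP-const c k = cong (_∷ []) (ℤ.+-identityʳ (c * c ^ k))

x-1ℤ : PolyZ
x-1ℤ = -1ℤ ∷ 1ℤ ∷ []

-- [x^i] (x-1)^m, that is (-1)^(m-i) * (m C i)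
signedBinomial : ℕ → ℕ → ℤ
signedBinomial m i = coeffℕ i (PZ.powP x-1ℤ m)

TutteX0-coeff : ∀ M i → coeffℕ i (TutteX0 M) ≡ ∑[ A ] signedBinomial (rkM M ∸ rk M A) i * -1ℤ ^ (∣ A ∣ ∸ rk M A)
TutteX0-coeff M i = begin
  coeffℕ i (map eval₀ (P2.sumP (map term L)))
    ≡⟨ cong (coeffℕ i) (map-eval₀-sumP (map term L)) ⟩
  coeffℕ i (PZ.sumP (map (map eval₀) (map term L)))
    ≡⟨ coeffℕ-sumP i (map (map eval₀) (map term L)) ⟩
  sumℤ (map (coeffℕ i) (map (map eval₀) (map term L)))
    ≡⟨ cong sumℤ (trans (sym (List.map-∘ _)) (sym (List.map-∘ L))) ⟩
  sumℤ (map (λ A → coeffℕ i (map eval₀ (term A))) L)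
    ≡⟨ sumℤ-allSubsets (n M) _ ⟩
  ∑[ A ] coeffℕ i (map eval₀ (term A))
    ≡⟨ ∑-cong (λ A → term-coeff (rkM M ∸ rk M A) (∣ A ∣ ∸ rk M A)) ⟩
  ∑[ A ] signedBinomial (rkM M ∸ rk M A) i * -1ℤ ^ (∣ A ∣ ∸ rk M A) ∎
  where
  open ≡-Reasoning
  L = allSubsets (n M)
  term : Subset (n M) → Poly2
  term A = P2.mulP (P2.powP x-1 (rkM M ∸ rk M A)) (P2.powP y-1 (∣ A ∣ ∸ rk M A))
  term-coeff : ∀ a b → coeffℕ i (map eval₀ (P2.mulP (P2.powP x-1 a) (P2.powP y-1 b)))
                     ≡ signedBinomial a i * -1ℤ ^ b
  term-coeff a b = begin
    coeffℕ i (map eval₀ (P2.mulP (P2.powP x-1 a) (P2.powP y-1 b)))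
      ≡⟨ cong (coeffℕ i) (map-eval₀-mulP (P2.powP x-1 a) (P2.powP y-1 b)) ⟩
    coeffℕ i (PZ.mulP (map eval₀ (P2.powP x-1 a)) (map eval₀ (P2.powP y-1 b)))
      ≡⟨ cong₂ (λ u v → coeffℕ i (PZ.mulP u v)) (map-eval₀-powP x-1 a)
               (trans (map-eval₀-powP y-1 b) (powP-const -1ℤ b)) ⟩
    coeffℕ i (PZ.mulP (PZ.powP x-1ℤ a) (-1ℤ ^ b ∷ []))
      ≡⟨ coeffℕ-mulP-const i (PZ.powP x-1ℤ a) _ ⟩
    signedBinomial a i * -1ℤ ^ b ∎


signedBinomial-suc : ∀ m i →
  signedBinomial (suc m) (suc i) ≡ - signedBinomial m (suc i) + signedBinomial m i
signedBinomial-suc m i = begin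
  -- (x-1) * Q = -Q + x * Q
  coeffℕ (suc i) (PZ.addP (PZ.scaleP -1ℤ Q) (0ℤ ∷ PZ.mulP (1ℤ ∷ []) Q))
    ≡⟨ coeffℕ-addP (suc i) (PZ.scaleP -1ℤ Q) _ ⟩
  coeffℕ (suc i) (PZ.scaleP -1ℤ Q) + coeffℕ i (PZ.addP (PZ.scaleP 1ℤ Q) (0ℤ ∷ []))
    ≡⟨ cong₂ _+_ (trans (coeffℕ-scaleP (suc i) -1ℤ Q) (ℤ.-1*i≡-i _)) shifted ⟩
  - signedBinomial m (suc i) + signedBinomial m i ∎
  where
  open ≡-Reasoning
  Q = PZ.powP x-1ℤ m
  shifted : coeffℕ i (PZ.addP (PZ.scaleP 1ℤ Q) (0ℤ ∷ [])) ≡ coeffℕ i Q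
  shifted = begin
    coeffℕ i (PZ.addP (PZ.scaleP 1ℤ Q) (0ℤ ∷ []))
      ≡⟨ coeffℕ-addP i (PZ.scaleP 1ℤ Q) (0ℤ ∷ []) ⟩
    coeffℕ i (PZ.scaleP 1ℤ Q) + coeffℕ i (0ℤ ∷ [])
      ≡⟨ cong₂ _+_ (trans (coeffℕ-scaleP i 1ℤ Q) (ℤ.*-identityˡ _)) (coeffℕ-const i) ⟩
    coeffℕ i Q + 0ℤ
      ≡⟨ ℤ.+-identityʳ _ ⟩
    coeffℕ i Q ∎
    where
    coeffℕ-const : ∀ i → coeffℕ i (0ℤ ∷ []) ≡ 0ℤ
    coeffℕ-const zero    = refl
    coeffℕ-const (suc i) = refl

signedBinomial-above : ∀ {m i} → m < i → signedBinomial m i ≡ 0ℤ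
signedBinomial-above {zero}  {suc i} _           = refl
signedBinomial-above {suc m} {suc i} (s≤s m<i) = begin
  signedBinomial (suc m) (suc i)                    ≡⟨ signedBinomial-suc m i ⟩
  - signedBinomial m (suc i) + signedBinomial m i
    ≡⟨ cong₂ (λ u v → - u + v) (signedBinomial-above (NP.m<n⇒m<1+n m<i)) (signedBinomial-above m<i) ⟩
  0ℤ                                                ∎
  where open ≡-Reasoning

signedBinomial-diag : ∀ m → signedBinomial m m ≡ 1ℤ
signedBinomial-diag zero    = refl
signedBinomial-diag (suc m) = begin
  signedBinomial (suc m) (suc m)
    ≡⟨ signedBinomial-suc m m ⟩
  - signedBinomial m (suc m) + signedBinomial m m
    ≡⟨ cong₂ (λ u v → - u + v) (signedBinomial-above (NP.n<1+n m)) (signedBinomial-diag m) ⟩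
  1ℤ ∎
  where open ≡-Reasoning

signedBinomial-sub1 : ∀ m → signedBinomial (suc m) m ≡ - + suc m
signedBinomial-sub1 zero    = refl
signedBinomial-sub1 (suc m) = begin
  signedBinomial (2 ℕ.+ m) (suc m)
    ≡⟨ signedBinomial-suc (suc m) m ⟩
  - signedBinomial (suc m) (suc m) + signedBinomial (suc m) m
    ≡⟨ cong₂ (λ u v → - u + v) (signedBinomial-diag (suc m)) (signedBinomial-sub1 m) ⟩
  - + (2 ℕ.+ m) ∎
  where open ≡-Reasoning

signedBinomial-sub2 : ∀ m → signedBinomial (2 ℕ.+ m) m ≡ + ((2 ℕ.+ m) C 2)
signedBinomial-sub2 zero    = refl
signedBinomial-sub2 (suc m) = begin
  signedBinomial (3 ℕ.+ m) (suc m)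
    ≡⟨ signedBinomial-suc (2 ℕ.+ m) m ⟩
  - signedBinomial (2 ℕ.+ m) (suc m) + signedBinomial (2 ℕ.+ m) m
    ≡⟨ cong₂ (λ u v → - u + v) (signedBinomial-sub1 (suc m)) (signedBinomial-sub2 m) ⟩
  - - + (2 ℕ.+ m) + + ((2 ℕ.+ m) C 2)
    ≡⟨ cong (_+ + ((2 ℕ.+ m) C 2)) (ℤ.neg-involutive (+ (2 ℕ.+ m))) ⟩
  + (2 ℕ.+ m) + + ((2 ℕ.+ m) C 2)
    ≡⟨ cong₂ (λ u v → + u + + v) (nC1≡n (2 ℕ.+ m)) refl ⟨
  + ((2 ℕ.+ m) C 1) + + ((2 ℕ.+ m) C 2)
    ≡⟨ cong +_ (nCk+nC[k+1]≡[n+1]C[k+1] (2 ℕ.+ m) 1) ⟩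
  + ((3 ℕ.+ m) C 2) ∎
  where open ≡-Reasoning

-1^-∸ : ∀ {j k} → j ≤ k → -1ℤ ^ (k ∸ j) ≡ -1ℤ ^ k * -1ℤ ^ j
-1^-∸ {zero}  {k}     z≤n       = sym (ℤ.*-identityʳ _)
-1^-∸ {suc j} {suc k} (s≤s j≤k) = trans (-1^-∸ j≤k) (squares (-1ℤ ^ k) (-1ℤ ^ j))
  where
  squares : ∀ x y → x * y ≡ (-1ℤ * x) * (-1ℤ * y)
  squares = solve-∀

signedBinomial-∸ : ∀ {r j} → suc j ≤ r → signedBinomial (r ∸ suc j) r ≡ 0ℤ
signedBinomial-∸ j<r = signedBinomial-above (NP.∸-monoʳ-< {o = 0} (s≤s z≤n) j<r)

summand-top : ∀ {r j} s → j ≤ r → signedBinomial (r ∸ j) r * (s * -1ℤ ^ j) ≡ [ j ≡ᵇ 0 ]· s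
summand-top {r} {zero}  s _   = trans (cong₂ _*_ (signedBinomial-diag r) (ℤ.*-identityʳ s)) (ℤ.*-identityˡ s)
summand-top {r} {suc j} s j<r =
  trans (cong (_* (s * -1ℤ ^ suc j)) (signedBinomial-∸ j<r)) (ℤ.*-zeroˡ (s * -1ℤ ^ suc j))

summand-sub1 : ∀ {k j} s → j ≤ suc k →
  signedBinomial (suc k ∸ j) k * (s * -1ℤ ^ j) ≡ - + suc k * [ j ≡ᵇ 0 ]· s - [ j ≡ᵇ 1 ]· s
summand-sub1 {k} {0} s _ = trans (cong (_* (s * 1ℤ)) (signedBinomial-sub1 k)) (ring (+ suc k) s)
  where ring : ∀ c s → - c * (s * 1ℤ) ≡ - c * s - 0ℤ
        ring = solve-∀
summand-sub1 {k} {1} s _ = trans (cong (_* (s * (-1ℤ * 1ℤ))) (signedBinomial-diag k)) (ring (+ suc k) s)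
  where ring : ∀ c s → 1ℤ * (s * (-1ℤ * 1ℤ)) ≡ - c * 0ℤ - s
        ring = solve-∀
summand-sub1 {k} {suc (suc j)} s (s≤s j<k) =
  trans (cong (_* _) (signedBinomial-∸ j<k)) (ring (+ suc k) (s * -1ℤ ^ suc (suc j)))
  where ring : ∀ c x → 0ℤ * x ≡ - c * 0ℤ - 0ℤ
        ring = solve-∀

summand-sub2 : ∀ {k j} s → j ≤ 2 ℕ.+ k →
  signedBinomial (2 ℕ.+ k ∸ j) k * (s * -1ℤ ^ j)
    ≡ + ((2 ℕ.+ k) C 2) * [ j ≡ᵇ 0 ]· s + + suc k * [ j ≡ᵇ 1 ]· s + [ j ≡ᵇ 2 ]· s
summand-sub2 {k} {0} s _ =
  trans (cong (_* (s * 1ℤ)) (signedBinomial-sub2 k)) (ring (+ ((2 ℕ.+ k) C 2)) (+ suc k) s)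
  where ring : ∀ b c s → b * (s * 1ℤ) ≡ b * s + c * 0ℤ + 0ℤ
        ring = solve-∀
summand-sub2 {k} {1} s _ =
  trans (cong (_* (s * (-1ℤ * 1ℤ))) (signedBinomial-sub1 k)) (ring (+ ((2 ℕ.+ k) C 2)) (+ suc k) s)
  where ring : ∀ b c s → - c * (s * (-1ℤ * 1ℤ)) ≡ b * 0ℤ + c * s + 0ℤ
        ring = solve-∀
summand-sub2 {k} {2} s _ =
  trans (cong (_* (s * (-1ℤ * (-1ℤ * 1ℤ)))) (signedBinomial-diag k)) (ring (+ ((2 ℕ.+ k) C 2)) (+ suc k) s)
  where ring : ∀ b c s → 1ℤ * (s * (-1ℤ * (-1ℤ * 1ℤ))) ≡ b * 0ℤ + c * 0ℤ + s
        ring = solve-∀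
summand-sub2 {k} {suc (suc (suc j))} s (s≤s (s≤s j<k)) =
  trans (cong (_* _) (signedBinomial-∸ j<k)) (ring (+ ((2 ℕ.+ k) C 2)) (+ suc k) (s * -1ℤ ^ suc (suc (suc j))))
  where ring : ∀ b c x → 0ℤ * x ≡ b * 0ℤ + c * 0ℤ + 0ℤ
        ring = solve-∀

-- Subsets and boolean reflection

∈⇔T-lookup : ∀ {n} {x : Fin n} {p : Subset n} → x ∈ p ⇔ T (lookup p x)
∈⇔T-lookup {x = x} {p} = mk⇔ (λ x∈p → from T-≡ (Vec.[]=⇒lookup x∈p))
                              (λ t → Vec.lookup⇒[]= x p (to T-≡ t))

∈-tabulate⇔ : ∀ {n} {x : Fin n} (g : Fin n → Bool) → x ∈ tabulate g ⇔ T (g x)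
∈-tabulate⇔ {x = x} g = mk⇔ (λ x∈ → subst T (Vec.lookup∘tabulate g x) (to ∈⇔T-lookup x∈))
                              (λ t → from ∈⇔T-lookup (subst T (sym (Vec.lookup∘tabulate g x)) t))

⊈⊥⇒nonempty : ∀ {n} {A : Subset n} → ¬ A ⊆ ⊥ → Nonempty A
⊈⊥⇒nonempty {A = A} A⊈⊥ with nonempty? A
... | yes nonempty = nonempty
... | no  empty    = contradiction (λ {x} x∈A → ⊆-reflexive (Empty-unique empty) x∈A) A⊈⊥

∪-lub : ∀ {n} {X Y Z : Subset n} → X ⊆ Z → Y ⊆ Z → X ∪ Y ⊆ Z
∪-lub {X = X} {Y} X⊆Z Y⊆Z x∈ with x∈p∪q⁻ X Y x∈
... | inj₁ x∈X = X⊆Z x∈X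
... | inj₂ x∈Y = Y⊆Z x∈Y

⁅⁆⊆ : ∀ {n} {e : Fin n} {A} → e ∈ A → ⁅ e ⁆ ⊆ A
⁅⁆⊆ {e = e} {A} e∈A x∈⁅e⁆ = subst (_∈ A) (sym (x∈⁅y⁆⇒x≡y e x∈⁅e⁆)) e∈A

∪-monoʳ-⊆ : ∀ {n} (B : Subset n) {X Y} → X ⊆ Y → B ∪ X ⊆ B ∪ Y
∪-monoʳ-⊆ B {X} {Y} X⊆Y = ∪-lub (p⊆p∪q Y) (⊆-trans X⊆Y (q⊆p∪q B Y))

∪-monoˡ-⊆ : ∀ {n} (B : Subset n) {X Y} → X ⊆ Y → X ∪ B ⊆ Y ∪ B
∪-monoˡ-⊆ B {X} {Y} X⊆Y = ∪-lub (⊆-trans X⊆Y (p⊆p∪q B)) (q⊆p∪q Y B)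

T-does⇔ : ∀ {A : Set} (a? : Dec A) → T (does a?) ⇔ A
T-does⇔ (yes a) = mk⇔ (λ _ → a) _
T-does⇔ (no ¬a) = mk⇔ (λ ()) ¬a

T-all⇔ : ∀ {n} (p : Fin n → Bool) → T (all p (allFin n)) ⇔ (∀ x → T (p x))
T-all⇔ {n} p = mk⇔ (λ t x → All.lookup (all⁺ p (allFin n) t) (∈-allFin x))
                   (λ t → all⁻ p {xs = allFin n} (All.tabulate (λ {x} _ → t x)))

T-any⇔ : ∀ {n} (p : Fin n → Bool) → T (any p (allFin n)) ⇔ ∃ (T ∘ p)
T-any⇔ {n} p = mk⇔ (λ t → Any.satisfied (any⁻ p (allFin n) t))
                   (λ (x , px) → any⁺ p (Any.map (λ { refl → px }) (∈-allFin x)))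

T-if⇔ : ∀ {b x} → T (if b then x else true) ⇔ (T b → T x)
T-if⇔ {true}  = mk⇔ (λ t _ → t) (λ f → f _)
T-if⇔ {false} = mk⇔ (λ _ ()) (λ _ → _)

-- Rank and closure

module Closure (M : Matroid) where

  private
    N = n M
    r = rk M

  rk-⊥ : r ⊥ ≡ 0
  rk-⊥ = NP.n≤0⇒n≡0 (subst (r ⊥ ≤_) (∣⊥∣≡0 N) (rk-card M ⊥))

  rk-⊆⊥ : ∀ {A} → A ⊆ ⊥ → r A ≡ 0
  rk-⊆⊥ {A} A⊆⊥ = NP.n≤0⇒n≡0 (subst (r A ≤_) rk-⊥ (rk-mono M A⊆⊥))

  rk≢0⇒nonempty : ∀ {A} → r A ≢ 0 → Nonempty A
  rk≢0⇒nonempty rA≢0 = ⊈⊥⇒nonempty (rA≢0 ∘ rk-⊆⊥)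

  -- X ⊆ cl B
  Spans : Subset N → Subset N → Set
  Spans B X = r (B ∪ X) ≤ r B

  spans-antimonoʳ : ∀ {B X Y} → X ⊆ Y → Spans B Y → Spans B X
  spans-antimonoʳ {B} X⊆Y = NP.≤-trans (rk-mono M (∪-monoʳ-⊆ B X⊆Y))

  spans-monoˡ : ∀ {A B X} → A ⊆ B → Spans A X → Spans B X
  spans-monoˡ {A} {B} {X} A⊆B A-spans = NP.+-cancelʳ-≤ (r A) (r (B ∪ X)) (r B) (begin
    r (B ∪ X) ℕ.+ r A                     ≤⟨ NP.+-mono-≤ (rk-mono M (∪-monoʳ-⊆ B (q⊆p∪q A X)))
                                                           (rk-mono M (λ x∈A → x∈p∩q⁺ (A⊆B x∈A , p⊆p∪q X x∈A))) ⟩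
    r (B ∪ (A ∪ X)) ℕ.+ r (B ∩ (A ∪ X))  ≤⟨ rk-submod M B (A ∪ X) ⟩
    r B ℕ.+ r (A ∪ X)                     ≤⟨ NP.+-monoʳ-≤ (r B) A-spans ⟩
    r B ℕ.+ r A                           ∎)
    where open NP.≤-Reasoning

  spans-∪ : ∀ {B X Y} → Spans B X → Spans B Y → Spans B (X ∪ Y)
  spans-∪ {B} {X} {Y} X-spanned Y-spanned = begin
    r (B ∪ (X ∪ Y)) ≡⟨ cong r (∪-assoc B X Y) ⟨
    r ((B ∪ X) ∪ Y) ≤⟨ spans-monoˡ (p⊆p∪q X) Y-spanned ⟩
    r (B ∪ X)       ≤⟨ X-spanned ⟩
    r B             ∎
    where open NP.≤-Reasoning

  spans-⋃ : ∀ {B} es → All (λ e → Spans B ⁅ e ⁆) es → Spans B (⋃ (map ⁅_⁆ es))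
  spans-⋃ {B} []       []       = NP.≤-reflexive (cong r (∪-identityʳ B))
  spans-⋃      (e ∷ es) (s ∷ ss) = spans-∪ s (spans-⋃ es ss)

  spans-elementwise : ∀ {B A} → (∀ {e} → e ∈ A → Spans B ⁅ e ⁆) → Spans B A
  spans-elementwise {B} {A} spanned =
    spans-antimonoʳ A⊆⋃ (spans-⋃ elements (All.map spanned (all-filter (_∈? A) (allFin N))))
    where
    elements = filter (_∈? A) (allFin N)
    ∈-⋃ : ∀ {x} es → x ∈ₗ es → x ∈ ⋃ (map ⁅_⁆ es)
    ∈-⋃ (e ∷ es) (here refl) = p⊆p∪q (⋃ (map ⁅_⁆ es)) (x∈⁅x⁆ e)
    ∈-⋃ (e ∷ es) (there x∈)  = q⊆p∪q ⁅ e ⁆ _ (∈-⋃ es x∈)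
    A⊆⋃ : A ⊆ ⋃ (map ⁅_⁆ elements)
    A⊆⋃ {x} x∈A = ∈-⋃ elements (∈-filter⁺ (_∈? A) (∈-allFin x) x∈A)

  spans⇔≡ : ∀ {B X} → Spans B X ⇔ r (B ∪ X) ≡ r B
  spans⇔≡ {B} {X} = mk⇔ (λ s → NP.≤-antisym s (rk-mono M (p⊆p∪q X))) NP.≤-reflexive

  spans-member : ∀ {B e} → e ∈ B → Spans B ⁅ e ⁆
  spans-member e∈B = rk-mono M (∪-lub ⊆-refl (⁅⁆⊆ e∈B))

  IsFlat : Subset N → Set
  IsFlat F = ∀ {e} → Spans F ⁅ e ⁆ → e ∈ F

  isFlatᵇ-reflects : ∀ {F} → T (isFlatᵇ M F) ⇔ IsFlat F
  isFlatᵇ-reflects {F} = mk⇔ sound complete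
    where
    -- isFlatᵇ tests its elements with a function local to Defs; this names it
    isFlatᵇ-as-all : ∃[ test ] isFlatᵇ M F ≡ all test (allFin N)
    isFlatᵇ-as-all = _ , refl
    test = proj₁ isFlatᵇ-as-all
    sound : T (isFlatᵇ M F) → IsFlat F
    sound flat {e} spanned with All.lookup (all⁺ test (allFin N) flat) (∈-allFin e)
    ... | test-e with r (F ∪ ⁅ e ⁆) ≡ᵇ r F in rk-eq | lookup F e in e∈F
    ...   | true  | true  = from ∈⇔T-lookup (from T-≡ e∈F)
    ...   | true  | false = ⊥-elim test-e
    ...   | false | _     = ⊥-elim (subst T rk-eq (NP.≡⇒≡ᵇ _ _ (to spans⇔≡ spanned)))
    test-holds : IsFlat F → ∀ e → T (test e)
    test-holds closed e with r (F ∪ ⁅ e ⁆) ≡ᵇ r F in rk-eq | lookup F e in e∈F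
    ... | true  | true  = _
    ... | false | false = _
    ... | true  | false = subst T e∈F (to ∈⇔T-lookup (closed (from spans⇔≡ (NP.≡ᵇ⇒≡ _ _ (from T-≡ rk-eq)))))
    ... | false | true  =
      subst T rk-eq (NP.≡⇒≡ᵇ _ _ (to spans⇔≡ (spans-member (from ∈⇔T-lookup (from T-≡ e∈F)))))
    complete : IsFlat F → T (isFlatᵇ M F)
    complete closed = all⁻ test {xs = allFin N} (All.tabulate λ {e} _ → test-holds closed e)

  cl : Subset N → Subset N
  cl A = tabulate (λ e → r (A ∪ ⁅ e ⁆) ≡ᵇ r A)

  ∈-cl⇔ : ∀ {A e} → e ∈ cl A ⇔ Spans A ⁅ e ⁆
  ∈-cl⇔ {A} {e} = mk⇔
    (λ e∈ → NP.≤-reflexive (NP.≡ᵇ⇒≡ _ _ (to (∈-tabulate⇔ _) e∈)))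
    (λ s → from (∈-tabulate⇔ _) (NP.≡⇒≡ᵇ _ _ (to spans⇔≡ s)))

  ⊆-cl : ∀ {A} → A ⊆ cl A
  ⊆-cl e∈A = from ∈-cl⇔ (spans-member e∈A)

  rk-cl : ∀ A → r (cl A) ≡ r A
  rk-cl A = NP.≤-antisym
    (NP.≤-trans (rk-mono M (q⊆p∪q A (cl A))) (spans-elementwise (to ∈-cl⇔)))
    (rk-mono M ⊆-cl)

  cl-isFlat : ∀ A → IsFlat (cl A)
  cl-isFlat A {e} spanned = from ∈-cl⇔ (begin
    r (A ∪ ⁅ e ⁆)     ≤⟨ rk-mono M (∪-monoˡ-⊆ ⁅ e ⁆ ⊆-cl) ⟩
    r (cl A ∪ ⁅ e ⁆)  ≤⟨ spanned ⟩
    r (cl A)          ≡⟨ rk-cl A ⟩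
    r A               ∎)
    where open NP.≤-Reasoning

  flat-≡-cl : ∀ {A F} → IsFlat F → A ⊆ F → r F ≤ r A → F ≡ cl A
  flat-≡-cl {A} {F} closed A⊆F rF≤rA = ⊆-antisym F⊆cl cl⊆F
    where
    F⊆cl : F ⊆ cl A
    F⊆cl e∈F = from ∈-cl⇔ (NP.≤-trans (rk-mono M (∪-lub A⊆F (⁅⁆⊆ e∈F))) rF≤rA)
    cl⊆F : cl A ⊆ F
    cl⊆F e∈cl = closed (spans-monoˡ A⊆F (to ∈-cl⇔ e∈cl))

-- Parallel classes and rank-two flats of a loopless matroid

module LooplessMatroid (M : Matroid) (loopless : Loopless M) where

  open Closure M

  private
    N = n M
    r = rk M
    ∅ : Subset N
    ∅ = ⊥

  rk-⁅⁆ : ∀ e → r ⁅ e ⁆ ≡ 1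
  rk-⁅⁆ e with r ⁅ e ⁆ | loopless e | subst (r ⁅ e ⁆ ≤_) (∣⁅x⁆∣≡1 e) (rk-card M ⁅ e ⁆)
  ... | zero        | nonzero | _         = contradiction refl nonzero
  ... | suc zero    | _       | _         = refl
  ... | suc (suc _) | _       | s≤s ()

  rk-nonempty : ∀ {A e} → e ∈ A → 1 ≤ r A
  rk-nonempty {A} {e} e∈A = subst (_≤ r A) (rk-⁅⁆ e) (rk-mono M (⁅⁆⊆ e∈A))

  rk≡0⇒≡⊥ : ∀ {A} → r A ≡ 0 → A ≡ ⊥
  rk≡0⇒≡⊥ rA≡0 = ⊆-antisym (λ x∈A → contradiction (subst (1 ≤_) rA≡0 (rk-nonempty x∈A)) λ ()) ⊥⊆

  Parallel : Fin N → Fin N → Set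
  Parallel e f = r (⁅ e ⁆ ∪ ⁅ f ⁆) ≡ 1

  parallel⇔spans : ∀ {e f} → Parallel e f ⇔ Spans ⁅ e ⁆ ⁅ f ⁆
  parallel⇔spans {e} {f} = mk⇔
    (λ p → NP.≤-reflexive (trans p (sym (rk-⁅⁆ e))))
    (λ s → NP.≤-antisym (subst (r (⁅ e ⁆ ∪ ⁅ f ⁆) ≤_) (rk-⁅⁆ e) s) (rk-nonempty (p⊆p∪q ⁅ f ⁆ (x∈⁅x⁆ e))))

  parallel-refl : ∀ e → Parallel e e
  parallel-refl e = from parallel⇔spans (spans-member (x∈⁅x⁆ e))

  parallel-sym : ∀ {e f} → Parallel e f → Parallel f e
  parallel-sym {e} {f} p = trans (cong r (∪-comm ⁅ f ⁆ ⁅ e ⁆)) p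

  parallel-trans : ∀ {e f g} → Parallel e f → Parallel f g → Parallel e g
  parallel-trans {e} {f} {g} ef fg = NP.≤-antisym
    (begin
      r (⁅ e ⁆ ∪ ⁅ g ⁆)          ≤⟨ rk-mono M (q⊆p∪q ⁅ f ⁆ _) ⟩
      r (⁅ f ⁆ ∪ (⁅ e ⁆ ∪ ⁅ g ⁆)) ≤⟨ spans-∪ (spans (parallel-sym ef)) (spans fg) ⟩
      r ⁅ f ⁆                    ≡⟨ rk-⁅⁆ f ⟩
      1                          ∎)
    (rk-nonempty (p⊆p∪q ⁅ g ⁆ (x∈⁅x⁆ e)))
    where
    open NP.≤-Reasoning
    spans : ∀ {a b} → Parallel a b → Spans ⁅ a ⁆ ⁅ b ⁆
    spans = to parallel⇔spans

  rk≡1⇒parallel : ∀ {A e f} → r A ≡ 1 → e ∈ A → f ∈ A → Parallel e f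
  rk≡1⇒parallel rA≡1 e∈A f∈A = NP.≤-antisym
    (NP.≤-trans (rk-mono M (∪-lub (⁅⁆⊆ e∈A) (⁅⁆⊆ f∈A))) (NP.≤-reflexive rA≡1))
    (rk-nonempty (p⊆p∪q _ (x∈⁅x⁆ _)))

  parallel⇒rk≡1 : ∀ {A e} → e ∈ A → (∀ {f} → f ∈ A → Parallel e f) → r A ≡ 1
  parallel⇒rk≡1 {A} {e} e∈A parallel = NP.≤-antisym
    (begin
      r A           ≤⟨ rk-mono M (q⊆p∪q ⁅ e ⁆ A) ⟩
      r (⁅ e ⁆ ∪ A) ≤⟨ spans-elementwise (to parallel⇔spans ∘ parallel) ⟩
      r ⁅ e ⁆       ≡⟨ rk-⁅⁆ e ⟩
      1             ∎)
    (rk-nonempty e∈A)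
    where open NP.≤-Reasoning

  T-nonloopᵇ : ∀ e → T (nonloopᵇ M e)
  T-nonloopᵇ e = subst (λ k → T (not (k ≡ᵇ 0))) (sym (rk-⁅⁆ e)) _

  T-parallelᵇ⇔ : ∀ {e f} → T (parallelᵇ M e f) ⇔ Parallel e f
  T-parallelᵇ⇔ {e} {f} rewrite rk-⁅⁆ e | rk-⁅⁆ f =
    mk⇔ (NP.≡ᵇ⇒≡ _ 1 ∘ proj₁ ∘ to T-∧) (λ p → from T-∧ (NP.≡⇒≡ᵇ _ 1 p , _))

  record IsParallelClass (F P : Subset N) : Set where
    field
      nonempty : Nonempty P
      ⊆F       : P ⊆ F
      parallel : ∀ {e f} → e ∈ P → f ∈ P → Parallel e f
      maximal  : ∀ {e} → e ∈ F → (∀ {f} → f ∈ P → Parallel e f) → e ∈ P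

  parClassInᵇ-reflects : ∀ {F P} → T (parClassInᵇ M F P) ⇔ IsParallelClass F P
  parClassInᵇ-reflects {F} {P} = mk⇔ sound complete
    where
    ∈⇒T : ∀ {e A} → e ∈ A → T (lookup A e)
    ∈⇒T = to ∈⇔T-lookup
    T⇒∈ : ∀ {A} e → T (lookup A e) → e ∈ A
    T⇒∈ e = from ∈⇔T-lookup

    sound : T (parClassInᵇ M F P) → IsParallelClass F P
    sound t with to T-∧ t
    ... | t-nonempty , t′ with to T-∧ t′
    ... | t-⊆F , t″ with to T-∧ t″
    ... | t-parallel , t-maximal = record
      { nonempty = let (e , e∈P) = to (T-any⇔ _) t-nonempty in e , T⇒∈ e e∈P
      ; ⊆F       = λ {e} e∈P → T⇒∈ e (proj₁ (to T-∧ (to T-if⇔ (to (T-all⇔ _) t-⊆F e) (∈⇒T e∈P))))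
      ; parallel = λ {e} {f} e∈P f∈P → to T-parallelᵇ⇔
          (to T-if⇔ (to (T-all⇔ _) (to (T-all⇔ _) t-parallel e) f) (from T-∧ (∈⇒T e∈P , ∈⇒T f∈P)))
      ; maximal  = λ {e} e∈F par → T⇒∈ e (to T-if⇔ (to (T-all⇔ _) t-maximal e)
          (from T-∧ (∈⇒T e∈F , from T-∧ (T-nonloopᵇ e , from (T-all⇔ _)
            (λ f → from T-if⇔ (λ f∈P → from T-parallelᵇ⇔ (par (T⇒∈ f f∈P))))))))
      }

    complete : IsParallelClass F P → T (parClassInᵇ M F P)
    complete class = from T-∧
      ( from (T-any⇔ _) (proj₁ nonempty , ∈⇒T (proj₂ nonempty))
      , from T-∧
      ( from (T-all⇔ _) (λ e → from T-if⇔ λ e∈P → from T-∧ (∈⇒T (⊆F (T⇒∈ e e∈P)) , T-nonloopᵇ e))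
      , from T-∧
      ( from (T-all⇔ _) (λ e → from (T-all⇔ _) λ f → from T-if⇔ λ both →
          from T-parallelᵇ⇔ (parallel (T⇒∈ e (proj₁ (to T-∧ both))) (T⇒∈ f (proj₂ (to T-∧ both)))))
      , from (T-all⇔ _) (λ e → from T-if⇔ λ cond →
          ∈⇒T (maximal (T⇒∈ e (proj₁ (to (T-∧ {lookup F e}) cond))) λ {f} f∈P → to T-parallelᵇ⇔
            (to T-if⇔ (to (T-all⇔ _) (proj₂ (to (T-∧ {nonloopᵇ M e}) (proj₂ (to (T-∧ {lookup F e}) cond)))) f)
                      (∈⇒T f∈P)))) )))
      where open IsParallelClass class

  parallelClass-unique : ∀ {F P P′} → IsParallelClass F P → IsParallelClass F P′ →
                         ∀ {e} → e ∈ P → e ∈ P′ → P ≡ P′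
  parallelClass-unique class class′ e∈P e∈P′ =
    ⊆-antisym (absorbed class class′ e∈P e∈P′) (absorbed class′ class e∈P′ e∈P)
    where
    absorbed : ∀ {F P P′} → IsParallelClass F P → IsParallelClass F P′ →
               ∀ {e} → e ∈ P → e ∈ P′ → P ⊆ P′
    absorbed class class′ e∈P e∈P′ f∈P =
      IsParallelClass.maximal class′ (IsParallelClass.⊆F class f∈P) λ g∈P′ →
        parallel-trans (IsParallelClass.parallel class f∈P e∈P) (IsParallelClass.parallel class′ e∈P′ g∈P′)

  classOf : Subset N → Fin N → Subset N
  classOf F e = tabulate (λ f → does (f ∈? F) ∧ (r (⁅ e ⁆ ∪ ⁅ f ⁆) ≡ᵇ 1))

  ∈-classOf⇔ : ∀ {F e f} → f ∈ classOf F e ⇔ (f ∈ F × Parallel e f)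
  ∈-classOf⇔ {F} {e} {f} = mk⇔
    (λ f∈ → let (f∈F , p) = to T-∧ (to (∈-tabulate⇔ _) f∈) in to (T-does⇔ (f ∈? F)) f∈F , NP.≡ᵇ⇒≡ _ 1 p)
    (λ (f∈F , p) → from (∈-tabulate⇔ _) (from T-∧ (from (T-does⇔ (f ∈? F)) f∈F , NP.≡⇒≡ᵇ _ 1 p)))

  classOf-isParallelClass : ∀ {F e} → e ∈ F → IsParallelClass F (classOf F e)
  classOf-isParallelClass {F} {e} e∈F = record
    { nonempty = e , e∈class
    ; ⊆F       = proj₁ ∘ to ∈-classOf⇔
    ; parallel = λ f∈ g∈ → parallel-trans (parallel-sym (proj₂ (to ∈-classOf⇔ f∈))) (proj₂ (to ∈-classOf⇔ g∈))
    ; maximal  = λ f∈F par → from ∈-classOf⇔ (f∈F , parallel-sym (par e∈class))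
    }
    where
    e∈class : e ∈ classOf F e
    e∈class = from ∈-classOf⇔ (e∈F , parallel-refl e)

  rank-one-in-unique-class : ∀ {F A} → A ⊆ F → r A ≡ 1 →
    ∃[ P₀ ] (IsParallelClass F P₀ × A ⊆ P₀) × (∀ {P} → IsParallelClass F P → A ⊆ P → P ≡ P₀)
  rank-one-in-unique-class {F} {A} A⊆F rA≡1 with rk≢0⇒nonempty (NP.1+n≢0 ∘ trans (sym rA≡1))
  ... | e , e∈A = classOf F e , (class₀ , A⊆class) ,
                  λ class A⊆P → parallelClass-unique class class₀ (A⊆P e∈A) (A⊆class e∈A)
    where
    class₀ = classOf-isParallelClass (A⊆F e∈A)
    A⊆class : A ⊆ classOf F e
    A⊆class f∈A = from ∈-classOf⇔ (A⊆F f∈A , rk≡1⇒parallel rA≡1 e∈A f∈A)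

  signedRankCount : Subset N → ℕ → ℤ
  signedRankCount F j = ∑[ A ] [ does (A ⊆? F) ]· [ r A ≡ᵇ j ]· sign A

  signedRankCount-0 : ∀ F → signedRankCount F 0 ≡ 1ℤ
  signedRankCount-0 F = begin
    signedRankCount F 0                          ≡⟨ ∑-cong (λ A → sym ([]·-∧ (does (A ⊆? F)) _ (sign A))) ⟩
    ∑[ A ] [ does (A ⊆? F) ∧ (r A ≡ᵇ 0) ]· sign A ≡⟨ ∑-unique _ sign ⊥-counted only-⊥ ⟩
    sign {N} ⊥                                   ≡⟨ cong (-1ℤ ^_) (∣⊥∣≡0 N) ⟩
    1ℤ                                           ∎
    where
    open ≡-Reasoning
    ⊥-counted : T (does (⊥ ⊆? F) ∧ (r ⊥ ≡ᵇ 0))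
    ⊥-counted = from T-∧ (from (T-does⇔ (⊥ ⊆? F)) ⊥⊆ , NP.≡⇒≡ᵇ _ 0 rk-⊥)
    only-⊥ : ∀ {A} → T (does (A ⊆? F) ∧ (r A ≡ᵇ 0)) → A ≡ ⊥
    only-⊥ {A} t = rk≡0⇒≡⊥ (NP.≡ᵇ⇒≡ _ 0 (proj₂ (to (T-∧ {does (A ⊆? F)}) t)))

  ∑-rank-one-in-class : ∀ {F P} → IsParallelClass F P →
    ∑[ A ] [ does (A ⊆? P) ]· [ does (A ⊆? F) ]· [ r A ≡ᵇ 1 ]· sign A ≡ -1ℤ
  ∑-rank-one-in-class {F} {P} class = begin
    ∑[ A ] [ does (A ⊆? P) ]· [ does (A ⊆? F) ]· [ r A ≡ᵇ 1 ]· sign A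
      ≡⟨ ∑-cong nonempty-subsets ⟩
    ∑[ A ] ([ does (A ⊆? P) ]· sign A - [ does (A ⊆? ∅) ]· sign A)
      ≡⟨ ∑-+ (λ A → [ does (A ⊆? P) ]· sign A) (λ A → - [ does (A ⊆? ∅) ]· sign A) ⟩
    ∑[ A ] [ does (A ⊆? P) ]· sign A + ∑[ A ] (- [ does (A ⊆? ∅) ]· sign A)
      ≡⟨ cong₂ _+_ (∑-sign-⊆ P) (trans (∑-neg (λ A → [ does (A ⊆? ∅) ]· sign A)) (cong -_ (∑-sign-⊆ ∅))) ⟩
    [ does (P ⊆? ∅) ]· 1ℤ - [ does (∅ ⊆? ∅) ]· 1ℤ
      ≡⟨ cong₂ (λ a b → [ a ]· 1ℤ - [ b ]· 1ℤ) (dec-false (P ⊆? ∅) P⊈⊥) (dec-true (∅ ⊆? ∅) ⊥⊆) ⟩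
    -1ℤ ∎
    where
    open ≡-Reasoning
    open IsParallelClass class
    P⊈⊥ : ¬ P ⊆ ⊥
    P⊈⊥ P⊆⊥ = ∉⊥ (P⊆⊥ (proj₂ nonempty))
    nonempty-subsets : ∀ A → [ does (A ⊆? P) ]· [ does (A ⊆? F) ]· [ r A ≡ᵇ 1 ]· sign A
                           ≡ [ does (A ⊆? P) ]· sign A - [ does (A ⊆? ∅) ]· sign A
    nonempty-subsets A with A ⊆? P | A ⊆? ∅
    ... | no A⊈P  | yes A⊆⊥ = contradiction (λ {x} → ⊆-trans A⊆⊥ ⊥⊆ {x}) A⊈P
    ... | no _    | no _    = refl
    ... | yes _   | yes A⊆⊥ rewrite rk-⊆⊥ A⊆⊥ =
      trans ([]·-zero (does (A ⊆? F))) (sym (ℤ.+-inverseʳ (sign A)))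
    ... | yes A⊆P | no A⊈⊥ with ⊈⊥⇒nonempty A⊈⊥
    ...   | _ , e∈A rewrite dec-true (A ⊆? F) (⊆-trans A⊆P ⊆F)
                          | parallel⇒rk≡1 e∈A (λ f∈A → parallel (A⊆P e∈A) (A⊆P f∈A)) =
      sym (ℤ.+-identityʳ (sign A))

  signedRankCount-1 : ∀ F → signedRankCount F 1 ≡ - + pF M F
  signedRankCount-1 F = begin
    signedRankCount F 1                                ≡⟨ ∑-fibres inClass g fibre ⟩
    ∑[ P ] ∑[ A ] [ inClass P A ]· g A                 ≡⟨ ∑-cong per-class ⟩
    ∑[ P ] (- [ parClassInᵇ M F P ]· 1ℤ)               ≡⟨ ∑-neg (λ P → [ parClassInᵇ M F P ]· 1ℤ) ⟩
    - (∑[ P ] [ parClassInᵇ M F P ]· 1ℤ)               ≡⟨ cong -_ (countSubsets-∑ N (parClassInᵇ M F)) ⟨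
    - + pF M F                                         ∎
    where
    open ≡-Reasoning
    g : Subset N → ℤ
    g A = [ does (A ⊆? F) ]· [ r A ≡ᵇ 1 ]· sign A
    inClass : Subset N → Subset N → Bool
    inClass P A = parClassInᵇ M F P ∧ does (A ⊆? P)
    fibre : ∀ A → g A ≡ 0ℤ ⊎ ∃[ P₀ ] T (inClass P₀ A) × (∀ {P} → T (inClass P A) → P ≡ P₀)
    fibre A with A ⊆? F | r A ≡ᵇ 1 in rA≡1
    ... | no _    | _     = inj₁ refl
    ... | yes _   | false = inj₁ refl
    ... | yes A⊆F | true with rank-one-in-unique-class A⊆F (NP.≡ᵇ⇒≡ _ 1 (from T-≡ rA≡1))
    ...   | P₀ , (class₀ , A⊆P₀) , unique =
      inj₂ (P₀ , from T-∧ (from parClassInᵇ-reflects class₀ , from (T-does⇔ (A ⊆? P₀)) A⊆P₀) , λ {P} t →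
        let (class , A⊆P) = to (T-∧ {parClassInᵇ M F P}) t
        in unique (to parClassInᵇ-reflects class) (to (T-does⇔ (A ⊆? P)) A⊆P))
    per-class : ∀ P → ∑[ A ] [ inClass P A ]· g A ≡ - [ parClassInᵇ M F P ]· 1ℤ
    per-class P with parClassInᵇ M F P in isClass
    ... | false = ∑-zero N
    ... | true  = ∑-rank-one-in-class (to parClassInᵇ-reflects (from T-≡ isClass))

  ∑-sign-⊆-by-rank : ∀ F → r F ≤ 2 →
    ∑[ A ] [ does (A ⊆? F) ]· sign A ≡ signedRankCount F 0 + signedRankCount F 1 + signedRankCount F 2
  ∑-sign-⊆-by-rank F rF≤2 = begin
    ∑[ A ] [ does (A ⊆? F) ]· sign A
      ≡⟨ ∑-cong by-rank ⟩
    ∑[ A ] (count 0 A + count 1 A + count 2 A)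
      ≡⟨ ∑-+ (λ A → count 0 A + count 1 A) (count 2) ⟩
    ∑[ A ] (count 0 A + count 1 A) + signedRankCount F 2
      ≡⟨ cong (_+ signedRankCount F 2) (∑-+ (count 0) (count 1)) ⟩
    signedRankCount F 0 + signedRankCount F 1 + signedRankCount F 2 ∎
    where
    open ≡-Reasoning
    count : ℕ → Subset N → ℤ
    count j A = [ does (A ⊆? F) ]· [ r A ≡ᵇ j ]· sign A
    split : ∀ k s → k ≤ 2 → s ≡ [ k ≡ᵇ 0 ]· s + [ k ≡ᵇ 1 ]· s + [ k ≡ᵇ 2 ]· s
    split 0 s _ = sym (trans (ℤ.+-identityʳ (s + 0ℤ)) (ℤ.+-identityʳ s))
    split 1 s _ = sym (trans (ℤ.+-identityʳ (0ℤ + s)) (ℤ.+-identityˡ s))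
    split 2 s _ = sym (ℤ.+-identityˡ s)
    split (suc (suc (suc _))) s (s≤s (s≤s ()))
    by-rank : ∀ A → [ does (A ⊆? F) ]· sign A ≡ count 0 A + count 1 A + count 2 A
    by-rank A with A ⊆? F
    ... | no  _   = refl
    ... | yes A⊆F = split (r A) (sign A) (NP.≤-trans (rk-mono M A⊆F) rF≤2)

  signedRankCount-2-flat : ∀ {F} → IsFlat F → r F ≡ 2 → signedRankCount F 2 ≡ + pF M F - 1ℤ
  signedRankCount-2-flat {F} flat rF≡2 = begin
    σ₂                                 ≡⟨ solve-for σ₂ (+ pF M F) ⟩
    (1ℤ - + pF M F + σ₂) + (+ pF M F - 1ℤ) ≡⟨ cong (_+ (+ pF M F - 1ℤ)) alternating-sum ⟨
    0ℤ + (+ pF M F - 1ℤ)               ≡⟨ ℤ.+-identityˡ _ ⟩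
    + pF M F - 1ℤ                      ∎
    where
    open ≡-Reasoning
    σ₂ = signedRankCount F 2
    solve-for : ∀ x p → x ≡ (1ℤ - p + x) + (p - 1ℤ)
    solve-for = solve-∀
    F⊈∅ : ¬ F ⊆ ∅
    F⊈∅ F⊆∅ = NP.1+n≢0 (trans (sym rF≡2) (rk-⊆⊥ F⊆∅))
    alternating-sum : 0ℤ ≡ 1ℤ - + pF M F + σ₂
    alternating-sum = begin
      0ℤ                                     ≡⟨ cong ([_]· 1ℤ) (dec-false (F ⊆? ∅) F⊈∅) ⟨
      [ does (F ⊆? ∅) ]· 1ℤ                  ≡⟨ ∑-sign-⊆ F ⟨
      ∑[ A ] [ does (A ⊆? F) ]· sign A       ≡⟨ ∑-sign-⊆-by-rank F (NP.≤-reflexive rF≡2) ⟩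
      signedRankCount F 0 + signedRankCount F 1 + σ₂
                                             ≡⟨ cong₂ (λ a b → a + b + σ₂) (signedRankCount-0 F) (signedRankCount-1 F) ⟩
      1ℤ - + pF M F + σ₂                     ∎

  signedRankCount-⊤-2 : signedRankCount ⊤ 2 ≡ sumFlats2 M
  signedRankCount-⊤-2 = begin
    signedRankCount ⊤ 2                              ≡⟨ ∑-fibres inFlat g fibre ⟩
    ∑[ F ] ∑[ A ] [ inFlat F A ]· g A                ≡⟨ ∑-cong per-flat ⟩
    ∑[ F ] [ rank2Flatᵇ F ]· (+ pF M F - 1ℤ)         ≡⟨ sumℤ-allSubsets N _ ⟨
    sumℤ (map (λ F → [ rank2Flatᵇ F ]· (+ pF M F - 1ℤ)) (allSubsets N))
                                                     ≡⟨ sumℤ-filterᵇ rank2Flatᵇ (λ F → + pF M F - 1ℤ) (allSubsets N) ⟨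
    sumFlats2 M                                      ∎
    where
    open ≡-Reasoning
    g : Subset N → ℤ
    g A = [ does (A ⊆? ⊤) ]· [ r A ≡ᵇ 2 ]· sign A
    rank2Flatᵇ : Subset N → Bool
    rank2Flatᵇ F = isFlatᵇ M F ∧ (r F ≡ᵇ 2)
    inFlat : Subset N → Subset N → Bool
    inFlat F A = rank2Flatᵇ F ∧ does (A ⊆? F)
    fibre : ∀ A → g A ≡ 0ℤ ⊎ ∃[ F₀ ] T (inFlat F₀ A) × (∀ {F} → T (inFlat F A) → F ≡ F₀)
    fibre A with r A ≡ᵇ 2 in rA≡2?
    ... | false = inj₁ ([]·-zero (does (A ⊆? ⊤)))
    ... | true  = inj₂ (cl A , from T-∧ (cl-rank2Flat , from (T-does⇔ (A ⊆? cl A)) ⊆-cl) , unique)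
      where
      rA≡2 = NP.≡ᵇ⇒≡ _ 2 (from T-≡ rA≡2?)
      cl-rank2Flat : T (rank2Flatᵇ (cl A))
      cl-rank2Flat = from T-∧ (from isFlatᵇ-reflects (cl-isFlat A) , NP.≡⇒≡ᵇ _ 2 (trans (rk-cl A) rA≡2))
      unique : ∀ {F} → T (inFlat F A) → F ≡ cl A
      unique {F} t =
        let (flat-and-rank , A⊆F) = to (T-∧ {rank2Flatᵇ F}) t
            (flat , rF≡2) = to (T-∧ {isFlatᵇ M F}) flat-and-rank
        in flat-≡-cl (to isFlatᵇ-reflects flat) (to (T-does⇔ (A ⊆? F)) A⊆F)
                     (NP.≤-reflexive (trans (NP.≡ᵇ⇒≡ _ 2 rF≡2) (sym rA≡2)))
    per-flat : ∀ F → ∑[ A ] [ inFlat F A ]· g A ≡ [ rank2Flatᵇ F ]· (+ pF M F - 1ℤ)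
    per-flat F with rank2Flatᵇ F in isRank2Flat
    ... | false = ∑-zero N
    ... | true  = let (flat , rF≡2) = to (T-∧ {isFlatᵇ M F}) (from T-≡ isRank2Flat) in begin
      ∑[ A ] [ does (A ⊆? F) ]· g A
        ≡⟨ ∑-cong (λ A → cong ([ does (A ⊆? F) ]·_) ([]·-T _ (from (T-does⇔ (A ⊆? ⊤)) ⊆⊤))) ⟩
      signedRankCount F 2
        ≡⟨ signedRankCount-2-flat (to isFlatᵇ-reflects flat) (NP.≡ᵇ⇒≡ _ 2 rF≡2) ⟩
      + pF M F - 1ℤ ∎

  signedRankCount-⊤ : ∀ j → signedRankCount ⊤ j ≡ ∑[ A ] [ r A ≡ᵇ j ]· sign A
  signedRankCount-⊤ j = ∑-cong {N} λ A → []·-T _ (from (T-does⇔ (A ⊆? ⊤)) ⊆⊤)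

  ∑-rank-0 : ∑[ A ] [ r A ≡ᵇ 0 ]· sign A ≡ 1ℤ
  ∑-rank-0 = trans (sym (signedRankCount-⊤ 0)) (signedRankCount-0 ⊤)

  ∑-rank-1 : ∑[ A ] [ r A ≡ᵇ 1 ]· sign A ≡ - + pM M
  ∑-rank-1 = trans (sym (signedRankCount-⊤ 1)) (signedRankCount-1 ⊤)

  ∑-rank-2 : ∑[ A ] [ r A ≡ᵇ 2 ]· sign A ≡ sumFlats2 M
  ∑-rank-2 = trans (sym (signedRankCount-⊤ 2)) signedRankCount-⊤-2

  rk≤rkM : ∀ A → r A ≤ rkM M
  rk≤rkM A = rk-mono M ⊆⊤

  ∑-rank-above : ∀ {j} → rkM M < j → ∑[ A ] [ r A ≡ᵇ j ]· sign A ≡ 0ℤ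
  ∑-rank-above {j} rkM<j = trans (∑-cong vanishes) (∑-zero N)
    where
    vanishes : ∀ A → [ r A ≡ᵇ j ]· sign A ≡ 0ℤ
    vanishes A with r A ≡ᵇ j in rA≡j
    ... | false = refl
    ... | true  = contradiction (subst (_≤ rkM M) (NP.≡ᵇ⇒≡ _ j (from T-≡ rA≡j)) (rk≤rkM A)) (NP.<⇒≱ rkM<j)

  pM≡0 : rkM M ≡ 0 → + pM M ≡ 0ℤ
  pM≡0 rank≡0 = ℤ.neg-injective (trans (sym ∑-rank-1) (∑-rank-above (s≤s (NP.≤-reflexive rank≡0))))

  sumFlats2≡0 : rkM M ≤ 1 → sumFlats2 M ≡ 0ℤ
  sumFlats2≡0 rank≤1 = trans (sym ∑-rank-2) (∑-rank-above (s≤s rank≤1))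

  coeffℕ-TutteX0 : ∀ {ρ} → rkM M ≡ ρ → ∀ i →
    coeffℕ i (TutteX0 M) ≡ ∑[ A ] signedBinomial (ρ ∸ r A) i * (sign A * -1ℤ ^ r A)
  coeffℕ-TutteX0 refl i =
    trans (TutteX0-coeff M i) (∑-cong λ A → cong (signedBinomial (rkM M ∸ r A) i *_) (-1^-∸ (rk-card M A)))

  coeff-top : coeff (+ rkM M) (TutteX0 M) ≡ + 1
  coeff-top = begin
    coeffℕ (rkM M) (TutteX0 M)
      ≡⟨ coeffℕ-TutteX0 refl (rkM M) ⟩
    ∑[ A ] signedBinomial (rkM M ∸ r A) (rkM M) * (sign A * -1ℤ ^ r A)
      ≡⟨ ∑-cong (λ A → summand-top (sign A) (rk≤rkM A)) ⟩
    ∑[ A ] [ r A ≡ᵇ 0 ]· sign A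
      ≡⟨ ∑-rank-0 ⟩
    1ℤ ∎
    where open ≡-Reasoning

  -- For small ρ the index is negative and coeff is 0, so p(M) or the flat sum must vanish.
  coeff-sub1 : ∀ {ρ} → rkM M ≡ ρ → coeff (+ ρ - + 1) (TutteX0 M) ≡ + pM M - + ρ
  coeff-sub1 {zero}  rank = sym (trans (ℤ.+-identityʳ (+ pM M)) (pM≡0 rank))
  coeff-sub1 {suc k} rank = begin
    coeffℕ k (TutteX0 M)
      ≡⟨ coeffℕ-TutteX0 rank k ⟩
    ∑[ A ] signedBinomial (suc k ∸ r A) k * (sign A * -1ℤ ^ r A)
      ≡⟨ ∑-cong (λ A → summand-sub1 (sign A) (subst (r A ≤_) rank (rk≤rkM A))) ⟩
    ∑[ A ] (- + suc k * σ 0 A - σ 1 A)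
      ≡⟨ ∑-+ (λ A → - + suc k * σ 0 A) (λ A → - σ 1 A) ⟩
    ∑[ A ] (- + suc k * σ 0 A) + ∑[ A ] (- σ 1 A)
      ≡⟨ cong₂ _+_ (∑-*ˡ (- + suc k) (σ 0)) (∑-neg (σ 1)) ⟩
    - + suc k * ∑ (σ 0) - ∑ (σ 1)
      ≡⟨ cong₂ (λ a b → - + suc k * a - b) ∑-rank-0 ∑-rank-1 ⟩
    - + suc k * 1ℤ - - + pM M
      ≡⟨ rearrange (+ suc k) (+ pM M) ⟩
    + pM M - + suc k ∎
    where
    open ≡-Reasoning
    σ : ℕ → Subset N → ℤ
    σ j A = [ r A ≡ᵇ j ]· sign A
    rearrange : ∀ c p → - c * 1ℤ - - p ≡ p - c
    rearrange = solve-∀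

  coeff-sub2 : ∀ {ρ} → rkM M ≡ ρ →
    coeff (+ ρ - + 2) (TutteX0 M) ≡ (+ (ρ C 2) - (+ ρ - + 1) * + pM M) + sumFlats2 M
  coeff-sub2 {zero}     rank =
    sym (cong₂ (λ p s → (0ℤ - -1ℤ * p) + s) (pM≡0 rank) (sumFlats2≡0 (subst (_≤ 1) (sym rank) z≤n)))
  coeff-sub2 {suc zero} rank = sym (cong (_+_ (0ℤ - 0ℤ * + pM M)) (sumFlats2≡0 (NP.≤-reflexive rank)))
  coeff-sub2 {suc (suc k)} rank = begin
    coeffℕ k (TutteX0 M)
      ≡⟨ coeffℕ-TutteX0 rank k ⟩
    ∑[ A ] signedBinomial (2 ℕ.+ k ∸ r A) k * (sign A * -1ℤ ^ r A)
      ≡⟨ ∑-cong (λ A → summand-sub2 (sign A) (subst (r A ≤_) rank (rk≤rkM A))) ⟩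
    ∑[ A ] (c * σ 0 A + d * σ 1 A + σ 2 A)
      ≡⟨ ∑-+ (λ A → c * σ 0 A + d * σ 1 A) (σ 2) ⟩
    ∑[ A ] (c * σ 0 A + d * σ 1 A) + ∑ (σ 2)
      ≡⟨ cong (_+ ∑ (σ 2)) (∑-+ (λ A → c * σ 0 A) (λ A → d * σ 1 A)) ⟩
    ∑[ A ] (c * σ 0 A) + ∑[ A ] (d * σ 1 A) + ∑ (σ 2)
      ≡⟨ cong₂ (λ a b → a + b + ∑ (σ 2)) (∑-*ˡ c (σ 0)) (∑-*ˡ d (σ 1)) ⟩
    c * ∑ (σ 0) + d * ∑ (σ 1) + ∑ (σ 2)
      ≡⟨ cong₂ (λ a b → c * a + d * b + ∑ (σ 2)) ∑-rank-0 ∑-rank-1 ⟩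
    c * 1ℤ + d * - + pM M + ∑ (σ 2)
      ≡⟨ cong (_+_ (c * 1ℤ + d * - + pM M)) ∑-rank-2 ⟩
    c * 1ℤ + d * - + pM M + sumFlats2 M
      ≡⟨ rearrange c d (+ pM M) (sumFlats2 M) ⟩
    (c - d * + pM M) + sumFlats2 M ∎
    where
    open ≡-Reasoning
    c = + ((2 ℕ.+ k) C 2)
    d = + suc k
    σ : ℕ → Subset N → ℤ
    σ j A = [ r A ≡ᵇ j ]· sign A
    rearrange : ∀ c d p s → c * 1ℤ + d * - p + s ≡ (c - d * p) + s
    rearrange = solve-∀

lemma2p5 : (M : Matroid) → Loopless M →
    (coeff (+ rkM M) (TutteX0 M) ≡ + 1)
    × (coeff (+ rkM M - + 1) (TutteX0 M) ≡ + pM M - + rkM M)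
    × (coeff (+ rkM M - + 2) (TutteX0 M)
        ≡ (+ (rkM M C 2) - (+ rkM M - + 1) * + pM M) + sumFlats2 M)
lemma2p5 M loopless = coeff-top , coeff-sub1 refl , coeff-sub2 refl
  where open LooplessMatroid M loopless
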